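{- Let the ordered signature $\mathcal{S}=(a_1,\dots,a_n)$ of $Q_n$ be saturated above direction $r$. Then the number of upright spanning trees of $Q_n$ with signature $\mathcal{S}$ equals the number of upright spanning trees of $Q_r$ with signature $(a_1,\dots,a_r)$. In particular, if $\mathrm{Unsat}(\mathcal{S})=(a_1,\dots,a_s)$, then the number of upright spanning trees of $Q_n$ with signature $\mathcal{S}$ equals the number of upright spanning trees of $Q_s$ with signature $\mathrm{Unsat}(\mathcal{S})$.
   Context: $[n]=\{1,\dots,n\}$. $Q_n$: vertices the subsets of $[n]$, edge between $X,Y$ iff $X\oplus Y=\{i\}$ for a single $i$ (the direction). The signature of a spanning tree $T$ is $(a_1,\dots,a_n)$ with $a_i$ the number of edges in direction $i$; ordered means $a_1\le\dots\le a_n$. For ordered $\mathcal{S}$, the excess at $k$ is $\varepsilon_k=\sum_{i=1}^k a_i-(2^k-1)$; $\mathcal{S}$ is saturated above direction $r$ (with $r<n$) if $\varepsilon_k=0$ for all $r\le k\le n$. If $s$ is the least index with $\varepsilon_k=0$ for all $s\le k\le n$, then $\mathrm{Unsat}(\mathcal{S})=(a_1,\dots,a_s)$. A spanning tree rooted at $\emptyset$ is upright if for each vertex $X$ the path in the tree from $X$ to $\emptyset$ has length $|X|$. -}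

module Defs where

open import Data.Bool using (Bool; true; false; if_then_else_)
open import Data.Nat using (ℕ; zero; suc; _+_; _∸_; _^_; _≤_; _<_)
open import Data.Fin using (Fin; inject≤)
import Data.Fin as F
open import Data.Fin.Subset using (Subset; ∣_∣)
open import Data.Vec using (Vec; []; _∷_; lookup; map; replicate; tabulate; _[_]%=_; _[_]≔_)
open import Data.List using (List; length; head; last)
open import Data.Maybe using (just)
open import Data.List.Relation.Unary.All using (All)
open import Data.List.Relation.Unary.Linked using (Linked)
open import Data.List.Relation.Unary.Unique.Propositional using (Unique)
open import Data.List.Membership.Propositional using (_∈_)
open import Data.Product using (Σ; _×_; Σ-syntax)
open import Relation.Binary.PropositionalEquality using (_≡_)
open import Data.Bool using (not)

-- Vertices of Q_n: subsets of [n] (coordinates Fin n; true = inside).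
V : ℕ → Set
V n = Subset n

emptyV : (n : ℕ) → V n
emptyV n = replicate n false

-- Tab n : a first-order table of one Bool per vertex of Q_n
-- (binary decision tree on the coordinates).
Tab : ℕ → Set
Tab zero = Bool
Tab (suc n) = Tab n × Tab n

lookupTab : {n : ℕ} → Tab n → V n → Bool
lookupTab {zero} b [] = b
lookupTab {suc n} (f Data.Product., t) (x ∷ X) = if x then lookupTab t X else lookupTab f X

countTab : {n : ℕ} → Tab n → ℕ
countTab {zero} b = if b then 1 else 0
countTab {suc n} (f Data.Product., t) = countTab f + countTab t

-- An edge set of Q_n: for each direction i, the table of lower endpoints X
-- (i ∉ X) such that the edge {X, X ∪ {i}} is present.
EdgeSet : ℕ → Set
EdgeSet n = Vec (Tab n) n

-- Canonical representation: no entry at X with i ∈ X.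
WellFormed : {n : ℕ} → EdgeSet n → Set
WellFormed {n} T = (i : Fin n) (X : V n) → lookup X i ≡ true → lookupTab (lookup T i) X ≡ false

Adj : {n : ℕ} → EdgeSet n → V n → V n → Set
Adj {n} T X Y = Σ[ i ∈ Fin n ] (Y ≡ X [ i ]%= not) × (lookupTab (lookup T i) (X [ i ]≔ false) ≡ true)

SimplePath : {n : ℕ} → EdgeSet n → V n → V n → List (V n) → Set
SimplePath T X Y vs = (head vs ≡ just X) × (last vs ≡ just Y) × Linked (Adj T) vs × Unique vs

IsSpanningTree : {n : ℕ} → EdgeSet n → Set
IsSpanningTree {n} T = (X Y : V n) →
  Σ (List (V n)) (SimplePath T X Y) ×
  ((p q : List (V n)) → SimplePath T X Y p → SimplePath T X Y q → p ≡ q)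

-- Upright (rooted at ∅): the tree path from X to ∅ has length |X| (edges),
-- i.e. |X| + 1 vertices.
Upright : {n : ℕ} → EdgeSet n → Set
Upright {n} T = (X : V n) (vs : List (V n)) → SimplePath T X (emptyV n) vs → length vs ≡ suc ∣ X ∣

signature : {n : ℕ} → EdgeSet n → Vec ℕ n
signature T = map countTab T

UST : (n : ℕ) → Vec ℕ n → EdgeSet n → Set
UST n S T = WellFormed T × IsSpanningTree T × Upright T × (signature T ≡ S)

NumberOf : {A : Set} → (A → Set) → ℕ → Set
NumberOf {A} P k = Σ[ L ∈ List A ] Unique L × All P L × ((x : A) → P x → x ∈ L) × (length L ≡ k)

Ordered : {n : ℕ} → Vec ℕ n → Set
Ordered {n} S = (i j : Fin n) → i F.≤ j → lookup S i ≤ lookup S j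

prefixSum : {n : ℕ} → Vec ℕ n → ℕ → ℕ
prefixSum S zero = 0
prefixSum [] (suc k) = 0
prefixSum (a ∷ S) (suc k) = a + prefixSum S k

-- ε_k = 0 for all s ≤ k ≤ n   (ε_k = 0  ⇔  a_1+…+a_k + 1 = 2^k)
ZeroExcessFrom : {n : ℕ} → Vec ℕ n → ℕ → Set
ZeroExcessFrom {n} S s = (k : ℕ) → s ≤ k → k ≤ n → prefixSum S k + 1 ≡ 2 ^ k

SaturatedAbove : {n : ℕ} → Vec ℕ n → ℕ → Set
SaturatedAbove {n} S r = (r < n) × ZeroExcessFrom S r

-- s is the least index with ε_k = 0 for all s ≤ k ≤ n (so Unsat(S) = (a_1,…,a_s))
IsUnsatIndex : {n : ℕ} → Vec ℕ n → ℕ → Set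
IsUnsatIndex {n} S s = ZeroExcessFrom S s × ((t : ℕ) → t ≤ n → ZeroExcessFrom S t → s ≤ t)

truncate : {n : ℕ} → Vec ℕ n → (r : ℕ) → r ≤ n → Vec ℕ r
truncate S r r≤n = tabulate (λ i → lookup S (inject≤ i r≤n))

IsSignature : (n : ℕ) → Vec ℕ n → Set
IsSignature n S = Σ[ T ∈ EdgeSet n ] WellFormed T × IsSpanningTree T × (signature T ≡ S)

{-# OPTIONS --safe #-}

-- An upright spanning tree of Q_n is the same thing as an edge set in which every nonempty
-- vertex X has exactly one edge down to some X ∖ {i} (a descent tree): these edges lead
-- from X to ∅ in |X| steps, and a simple path can never climb into a subtree that it would
-- have to leave again. If the signature is saturated at m and at m + 1, the 2^m − 1 edges
-- of the first m directions are all used up by the nonempty vertices of the face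
-- x_{m+1} = 0, so every vertex of the face x_{m+1} = 1 descends in direction m + 1. A
-- descent tree of Q_{m+1} with signature (S, 2^m) is therefore its restriction to the
-- bottom face together with all 2^m edges of direction m + 1, and restriction identifies
-- these trees with the descent trees of Q_m with signature S. Removing saturated
-- directions one at a time gives the corollary.

module Submission where

open import Defs
open import Data.Bool using (Bool; true; false; not; _∧_; _∨_)
import Data.Bool.Properties as Boolₚ
open import Data.Empty using (⊥-elim)
open import Data.Fin using (Fin; zero; suc; inject₁; fromℕ; inject≤)
import Data.Fin.Properties as Finₚ
open import Data.Fin.Properties using (any?)
open import Data.Fin.Subset using (∣_∣)
open import Data.Fin.Subset.Properties using (∣⊥∣≡0)
import Data.List as List
open import Data.List using (List; []; _∷_; _++_; _ʳ++_; reverse; head; last; length)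
open import Data.List.Properties
  using (length-map; unfold-reverse; reverse-involutive; reverse-injective; ∷-injectiveʳ; length-++)
open import Data.List.Membership.Propositional using (_∈_; _∉_)
open import Data.List.Membership.Propositional.Properties using (∈-∃++; ∈-map⁺)
import Data.List.Membership.DecPropositional as DecMembership
open import Data.List.Relation.Binary.Permutation.Propositional using (↭-sym; ↭⇒↭ₛ)
open import Data.List.Relation.Binary.Permutation.Propositional.Properties using (↭-reverse)
import Data.List.Relation.Binary.Permutation.Setoid.Properties as Permutationₛ
open import Data.List.Relation.Unary.All using (All; []; _∷_)
import Data.List.Relation.Unary.All as All
import Data.List.Relation.Unary.All.Properties as Allₚ
open import Data.List.Relation.Unary.All.Properties using (¬Any⇒All¬; All¬⇒¬Any)
open import Data.List.Relation.Unary.Any using (here; there)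
open import Data.List.Relation.Unary.AllPairs using ([]; _∷_)
open import Data.List.Relation.Unary.Linked using (Linked; []; [-]; _∷_; _∷′_)
import Data.List.Relation.Unary.Linked as Linked
import Data.List.Relation.Unary.Linked.Properties as Linkedₚ
open import Data.List.Relation.Unary.Unique.Propositional using (Unique)
open import Data.Maybe using (just)
open import Data.Maybe.Properties using (just-injective)
open import Data.Maybe.Relation.Binary.Connected using (Connected; just-nothing)
import Data.Maybe.Relation.Binary.Connected as Connected
open import Data.Nat.GeneralisedArithmetic using (iterate)
open import Data.Nat using (ℕ; zero; suc; _+_; _≤_; _<_; _^_; s≤s; z≤n)
open import Data.Nat.Properties
open import Algebra.Properties.CommutativeSemigroup +-commutativeSemigroup using (interchange; xy∙z≈xz∙y)
open import Algebra.Properties.CommutativeMonoid.Sum +-0-commutativeMonoid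
  using (sum; sum-cong-≗; sum-init-last; sum-replicate-zero)
open import Data.Product using (Σ; Σ-syntax; _×_; _,_; proj₁; proj₂)
open import Data.Sum using (_⊎_; inj₁; inj₂)
open import Data.Vec using (Vec; []; _∷_; _∷ʳ_; lookup; tabulate; initLast; _[_]%=_; _[_]≔_)
import Data.Vec as Vec
open import Data.Vec.Properties
  using ( ≡-dec; lookup-map; lookup∘tabulate; tabulate∘lookup; tabulate-cong; map-∷ʳ; map-∘; map-cong
        ; ∷ʳ-injectiveˡ; []≔-idempotent; updateAt-cong-local; updateAt-updateAt-local; updateAt-id
        ; updateAt-id-local; lookup∘updateAt; lookup∘update; lookup∘update′; lookup-replicate)
open import Function using (_∘_; id)
open import Function.Bundles using (_⇔_; mk⇔; Equivalence)
open import Function.Properties.Equivalence using (⇔-setoid)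
open import Level using (0ℓ)
open import Relation.Binary using (Rel; Symmetric; DecidableEquality)
open import Relation.Binary.Construct.Closure.Reflexive using (ReflClosure; [_])
import Relation.Binary.Construct.Closure.Reflexive as Refl
open import Relation.Binary.PropositionalEquality
import Relation.Binary.Reasoning.Setoid as SetoidReasoning
open import Relation.Nullary using (yes; no; contradiction)

module _ {A : Set} where

  last-++ : (xs : List A) (y : A) (ys : List A) → last (xs ++ y ∷ ys) ≡ last (y ∷ ys)
  last-++ []            y ys = refl
  last-++ (x ∷ [])      y ys = refl
  last-++ (x ∷ x′ ∷ xs) y ys = last-++ (x′ ∷ xs) y ys

  last-++-just : (xs : List A) {ys : List A} {a : A} → last ys ≡ just a → last (xs ++ ys) ≡ just a
  last-++-just xs {y ∷ ys} eq = trans (last-++ xs y ys) eq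

  last-reverse : (xs : List A) → last (reverse xs) ≡ head xs
  last-reverse []       = refl
  last-reverse (x ∷ xs) = trans (cong last (unfold-reverse x xs)) (last-++ (reverse xs) x [])

  head-reverse : (xs : List A) → head (reverse xs) ≡ last xs
  head-reverse xs = trans (sym (last-reverse (reverse xs))) (cong last (reverse-involutive xs))

  last∈ : (xs : List A) {a : A} → last xs ≡ just a → a ∈ xs
  last∈ (x ∷ [])     refl = here refl
  last∈ (x ∷ y ∷ xs) eq   = there (last∈ (y ∷ xs) eq)

  Unique-reverse : {xs : List A} → Unique xs → Unique (reverse xs)
  Unique-reverse {xs} = Permutationₛ.Unique-resp-↭ (setoid A) (↭⇒↭ₛ (↭-sym (↭-reverse xs)))

  Unique-++⁻ʳ : (xs : List A) {ys : List A} → Unique (xs ++ ys) → Unique ys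
  Unique-++⁻ʳ []       u       = u
  Unique-++⁻ʳ (x ∷ xs) (_ ∷ u) = Unique-++⁻ʳ xs u

  module _ {R : Rel A 0ℓ} where

    Linked-++⁻ʳ : (xs : List A) {ys : List A} → Linked R (xs ++ ys) → Linked R ys
    Linked-++⁻ʳ []            l       = l
    Linked-++⁻ʳ (x ∷ [])      l       = Linked.tail l
    Linked-++⁻ʳ (x ∷ x′ ∷ xs) (_ ∷ l) = Linked-++⁻ʳ (x′ ∷ xs) l

    Linked-ʳ++ : Symmetric R → {xs ys : List A} →
                 Linked R xs → Connected R (head xs) (head ys) → Linked R ys → Linked R (xs ʳ++ ys)
    Linked-ʳ++ sym {[]}     _  _ l = l
    Linked-ʳ++ sym {x ∷ xs} lx c l =
      Linked-ʳ++ sym (Linked.tail lx) (Connected.sym sym (Linked.head′ lx)) (c ∷′ l)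

    Linked-reverse : Symmetric R → {xs : List A} → Linked R xs → Linked R (reverse xs)
    Linked-reverse sym {[]}     _ = []
    Linked-reverse sym {x ∷ xs} l = Linked-ʳ++ sym l just-nothing []

module _ {A : Set} (_≟_ : DecidableEquality A) {R : Rel A 0ℓ} where
  open DecMembership _≟_ using (_∈?_)

  loop-erase : (xs : List A) → Linked (ReflClosure R) xs →
    Σ[ ys ∈ List A ] Linked R ys × Unique ys × head ys ≡ head xs × last ys ≡ last xs
  loop-erase []           _ = [] , [] , [] , refl , refl
  loop-erase (x ∷ [])     _ = x ∷ [] , [-] , [] ∷ [] , refl , refl
  loop-erase (x ∷ y ∷ xs) (r ∷ l) with loop-erase (y ∷ xs) l
  ... | ys , lys , uys , hy , ly with x ∈? ys
  ...   | yes x∈ys with pre , post , refl ← ∈-∃++ x∈ys =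
    x ∷ post , Linked-++⁻ʳ pre lys , Unique-++⁻ʳ pre uys , refl , trans (sym (last-++ pre x post)) ly
  loop-erase (x ∷ y ∷ xs) (r ∷ l) | y ∷ ys , lys , uys , refl , ly | no x∉ys with r
  ... | Refl.refl = ⊥-elim (x∉ys (here refl))
  ... | [ rxy ]   = x ∷ y ∷ ys , rxy ∷ lys , ¬Any⇒All¬ (y ∷ ys) x∉ys ∷ uys , refl , ly

Unique-map-injectiveOn : {A B : Set} {P : A → Set} (f : A → B) → (∀ {x y} → P x → P y → f x ≡ f y → x ≡ y) →
                         {xs : List A} → All P xs → Unique xs → Unique (List.map f xs)
Unique-map-injectiveOn f injective []         []         = []
Unique-map-injectiveOn f injective (px ∷ pxs) (x∉ ∷ u) =
  Allₚ.map⁺ (All.zipWith (λ (py , x≢y) fx≡fy → x≢y (injective px py fx≡fy)) (pxs , x∉)) ∷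
  Unique-map-injectiveOn f injective pxs u

record Correspondence {A B : Set} (P : A → Set) (Q : B → Set) : Set where
  field
    to        : A → B
    from      : B → A
    to-resp   : ∀ x → P x → Q (to x)
    from-resp : ∀ y → Q y → P (from y)
    from∘to   : ∀ x → P x → from (to x) ≡ x
    to∘from   : ∀ y → Q y → to (from y) ≡ y

Correspondence-sym : {A B : Set} {P : A → Set} {Q : B → Set} → Correspondence P Q → Correspondence Q P
Correspondence-sym c = record
  { to = from ; from = to ; to-resp = from-resp ; from-resp = to-resp ; from∘to = to∘from ; to∘from = from∘to }
  where open Correspondence c

NumberOf-map : {A B : Set} {P : A → Set} {Q : B → Set} {k : ℕ} → Correspondence P Q → NumberOf P k → NumberOf Q k
NumberOf-map {P = P} c (L , unique , all-P , complete , length≡k) =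
  List.map to L ,
  Unique-map-injectiveOn to to-injectiveOn all-P unique ,
  Allₚ.map⁺ (All.map (to-resp _) all-P) ,
  (λ y qy → subst (_∈ List.map to L) (to∘from y qy) (∈-map⁺ to (complete (from y) (from-resp y qy)))) ,
  trans (length-map to L) length≡k
  where
  open Correspondence c
  to-injectiveOn : ∀ {x y} → P x → P y → to x ≡ to y → x ≡ y
  to-injectiveOn {x} {y} px py eq = trans (sym (from∘to x px)) (trans (cong from eq) (from∘to y py))

NumberOf-correspondence : {A B : Set} {P : A → Set} {Q : B → Set} {k : ℕ} →
                          Correspondence P Q → NumberOf P k ⇔ NumberOf Q k
NumberOf-correspondence c = mk⇔ (NumberOf-map c) (NumberOf-map (Correspondence-sym c))

NumberOf-cong : {A : Set} {P Q : A → Set} {k : ℕ} → (∀ x → P x ⇔ Q x) → NumberOf P k ⇔ NumberOf Q k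
NumberOf-cong P⇔Q = NumberOf-correspondence record
  { to = id ; from = id ; to-resp = Equivalence.to ∘ P⇔Q ; from-resp = Equivalence.from ∘ P⇔Q
  ; from∘to = λ _ _ → refl ; to∘from = λ _ _ → refl }

module _ {n : ℕ} where

  flip-true : (X : V n) (i : Fin n) → lookup X i ≡ true → X [ i ]%= not ≡ X [ i ]≔ false
  flip-true X i Xᵢ = updateAt-cong-local i X (cong not Xᵢ)

  flip-involutive : (X : V n) (i : Fin n) → (X [ i ]%= not) [ i ]%= not ≡ X
  flip-involutive X i = trans (updateAt-updateAt-local i X (Boolₚ.not-involutive _)) (updateAt-id i X)

  clear-flip : (X : V n) (i : Fin n) → (X [ i ]%= not) [ i ]≔ false ≡ X [ i ]≔ false
  clear-flip X i = updateAt-updateAt-local i X refl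

  []≔-lookup′ : (X : V n) (i : Fin n) {b : Bool} → lookup X i ≡ b → X [ i ]≔ b ≡ X
  []≔-lookup′ X i Xᵢ = updateAt-id-local i X (sym Xᵢ)

∣set∣≡1+∣clear∣ : {n : ℕ} (X : V n) (i : Fin n) → ∣ X [ i ]≔ true ∣ ≡ suc ∣ X [ i ]≔ false ∣
∣set∣≡1+∣clear∣ (x ∷ X)     zero    = refl
∣set∣≡1+∣clear∣ (true ∷ X)  (suc i) = cong suc (∣set∣≡1+∣clear∣ X i)
∣set∣≡1+∣clear∣ (false ∷ X) (suc i) = ∣set∣≡1+∣clear∣ X i

∣clear∣≤∣∣ : {n : ℕ} (X : V n) (i : Fin n) → ∣ X [ i ]≔ false ∣ ≤ ∣ X ∣
∣clear∣≤∣∣ (true ∷ X)  zero    = n≤1+n _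
∣clear∣≤∣∣ (false ∷ X) zero    = ≤-refl
∣clear∣≤∣∣ (true ∷ X)  (suc i) = s≤s (∣clear∣≤∣∣ X i)
∣clear∣≤∣∣ (false ∷ X) (suc i) = ∣clear∣≤∣∣ X i

∣∣≡1+∣clear∣ : {n : ℕ} (X : V n) (i : Fin n) → lookup X i ≡ true → ∣ X ∣ ≡ suc ∣ X [ i ]≔ false ∣
∣∣≡1+∣clear∣ X i Xᵢ = trans (cong ∣_∣ (sym ([]≔-lookup′ X i Xᵢ))) (∣set∣≡1+∣clear∣ X i)

∣∣≡0⇒empty : {n : ℕ} (X : V n) → ∣ X ∣ ≡ 0 → X ≡ emptyV n
∣∣≡0⇒empty []          _  = refl
∣∣≡0⇒empty (false ∷ X) eq = cong (false ∷_) (∣∣≡0⇒empty X eq)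

nonempty : {n : ℕ} → V n → Bool
nonempty []      = false
nonempty (x ∷ X) = x ∨ nonempty X

nonempty≡false⇒empty : {n : ℕ} (X : V n) → nonempty X ≡ false → X ≡ emptyV n
nonempty≡false⇒empty []          _  = refl
nonempty≡false⇒empty (false ∷ X) eq = cong (false ∷_) (nonempty≡false⇒empty X eq)

lookup⇒nonempty : {n : ℕ} (X : V n) (i : Fin n) → lookup X i ≡ true → nonempty X ≡ true
lookup⇒nonempty (true ∷ X)  zero    _  = refl
lookup⇒nonempty (true ∷ X)  (suc i) _  = refl
lookup⇒nonempty (false ∷ X) (suc i) Xᵢ = lookup⇒nonempty X i Xᵢ

∣∣≡suc⇒nonempty : {n k : ℕ} (X : V n) → ∣ X ∣ ≡ suc k → nonempty X ≡ true
∣∣≡suc⇒nonempty (true ∷ X)  _  = refl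
∣∣≡suc⇒nonempty (false ∷ X) eq = ∣∣≡suc⇒nonempty X eq

nonempty⇒∣∣≢0 : {n : ℕ} (X : V n) → nonempty X ≡ true → ∣ X ∣ ≢ 0
nonempty⇒∣∣≢0 (true ∷ X)  _  ()
nonempty⇒∣∣≢0 (false ∷ X) ne = nonempty⇒∣∣≢0 X ne

_≟V_ : {n : ℕ} → DecidableEquality (V n)
_≟V_ = ≡-dec Boolₚ._≟_

∣emptyV∣≤∣∣ : {n : ℕ} (X : V n) → ∣ emptyV n ∣ ≤ ∣ X ∣
∣emptyV∣≤∣∣ {n} X = subst (_≤ ∣ X ∣) (sym (∣⊥∣≡0 n)) z≤n

≢-smaller⇒nonempty : {n : ℕ} {X Y : V n} → X ≢ Y → ∣ Y ∣ ≤ ∣ X ∣ → nonempty X ≡ true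
≢-smaller⇒nonempty {n} {X} {Y} X≢Y Y≤X with nonempty X in ne
... | true  = refl
... | false = ⊥-elim (X≢Y (trans X≡∅ (sym Y≡∅)))
  where
  X≡∅ : X ≡ emptyV n
  X≡∅ = nonempty≡false⇒empty X ne
  Y≡∅ : Y ≡ emptyV n
  Y≡∅ = ∣∣≡0⇒empty Y (n≤0⇒n≡0 (subst (∣ Y ∣ ≤_) (trans (cong ∣_∣ X≡∅) (∣⊥∣≡0 n)) Y≤X))

bit : Bool → ℕ
bit false = 0
bit true  = 1

∧≡true⇒ˡ : {a b : Bool} → a ∧ b ≡ true → a ≡ true
∧≡true⇒ˡ {true} _ = refl

bit≡1⇒true : {b : Bool} → bit b ≡ 1 → b ≡ true
bit≡1⇒true {true} _ = refl

sum-bit≡0 : {n : ℕ} (f : Fin n → Bool) → (∀ i → f i ≡ false) → sum (bit ∘ f) ≡ 0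
sum-bit≡0 {n} f f≡false = trans (sum-cong-≗ (cong bit ∘ f≡false)) (sum-replicate-zero n)

sum-bit≡0⇒false : {n : ℕ} (f : Fin n → Bool) → sum (bit ∘ f) ≡ 0 → ∀ i → f i ≡ false
sum-bit≡0⇒false {suc n} f eq i with f zero in f₀
sum-bit≡0⇒false {suc n} f eq zero    | false = f₀
sum-bit≡0⇒false {suc n} f eq (suc i) | false = sum-bit≡0⇒false (f ∘ suc) eq i

sum-bit≡1 : {n : ℕ} (f : Fin n → Bool) (i : Fin n) → f i ≡ true → (∀ j → f j ≡ true → j ≡ i) →
            sum (bit ∘ f) ≡ 1
sum-bit≡1 {suc n} f zero fᵢ only rewrite fᵢ =
  cong suc (sum-bit≡0 (f ∘ suc) λ j → Boolₚ.¬-not λ fⱼ → Finₚ.0≢1+n (sym (only (suc j) fⱼ)))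
sum-bit≡1 {suc n} f (suc i) fᵢ only with f zero in f₀
... | true  = ⊥-elim (Finₚ.0≢1+n (only zero f₀))
... | false = sum-bit≡1 (f ∘ suc) i fᵢ (λ j fⱼ → Finₚ.suc-injective (only (suc j) fⱼ))

sum-bit≡1⇒unique : {n : ℕ} (f : Fin n → Bool) → sum (bit ∘ f) ≡ 1 →
                   ∀ i j → f i ≡ true → f j ≡ true → i ≡ j
sum-bit≡1⇒unique {suc n} f eq zero    zero    _  _  = refl
sum-bit≡1⇒unique {suc n} f eq zero    (suc j) fᵢ fⱼ rewrite fᵢ
  with () ← trans (sym (sum-bit≡0⇒false (f ∘ suc) (suc-injective eq) j)) fⱼ
sum-bit≡1⇒unique {suc n} f eq (suc i) zero    fᵢ fⱼ rewrite fⱼ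
  with () ← trans (sym (sum-bit≡0⇒false (f ∘ suc) (suc-injective eq) i)) fᵢ
sum-bit≡1⇒unique {suc n} f eq (suc i) (suc j) fᵢ fⱼ with f zero in f₀
... | false = cong suc (sum-bit≡1⇒unique (f ∘ suc) eq i j fᵢ fⱼ)
... | true with () ← trans (sym (sum-bit≡0⇒false (f ∘ suc) (suc-injective eq) i)) fᵢ

-- Descent trees

module _ {n : ℕ} (T : EdgeSet n) where

  downEdge : Fin n → V n → Bool
  downEdge i X = lookup X i ∧ lookupTab (lookup T i) (X [ i ]≔ false)

  downDegree : V n → ℕ
  downDegree X = sum (λ i → bit (downEdge i X))

  DownEdge : V n → V n → Set
  DownEdge X Z = Σ[ i ∈ Fin n ] downEdge i X ≡ true × Z ≡ X [ i ]≔ false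

IsDescentTree : {n : ℕ} → EdgeSet n → Set
IsDescentTree T = WellFormed T × (∀ X → downDegree T X ≡ bit (nonempty X))

module Edges {n : ℕ} (T : EdgeSet n) where

  DownEdge⇒Adj : {X Z : V n} → DownEdge T X Z → Adj T X Z
  DownEdge⇒Adj {X} (i , down , refl) with true ← lookup X i in Xᵢ =
    i , sym (flip-true X i Xᵢ) , down

  Adj-sym : Symmetric (Adj T)
  Adj-sym {X} (i , refl , e) = i , sym (flip-involutive X i) , trans (cong (lookupTab _) (clear-flip X i)) e

  Adj⇒DownEdge : {X Z : V n} → Adj T X Z → DownEdge T X Z ⊎ DownEdge T Z X
  Adj⇒DownEdge {X} (i , refl , e) with lookup X i in Xᵢ
  ... | true  = inj₁ (i , trans (cong (_∧ lookupTab (lookup T i) (X [ i ]≔ false)) Xᵢ) e , flip-true X i Xᵢ)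
  ... | false = inj₂ (i , down , sym (trans (clear-flip X i) ([]≔-lookup′ X i Xᵢ)))
    where
    down : downEdge T i (X [ i ]%= not) ≡ true
    down = trans (cong₂ _∧_ (trans (lookup∘updateAt i X) (cong not Xᵢ)) (cong (lookupTab _) (clear-flip X i))) e

  downEdge-emptyV : (i : Fin n) → downEdge T i (emptyV n) ≡ false
  downEdge-emptyV i rewrite lookup-replicate i false = refl

  downEdge-upper : (i : Fin n) (X : V n) → lookup X i ≡ false →
                   downEdge T i (X [ i ]≔ true) ≡ lookupTab (lookup T i) X
  downEdge-upper i X Xᵢ =
    cong₂ _∧_ (lookup∘update i X true)
              (cong (lookupTab (lookup T i)) (trans ([]≔-idempotent X i) ([]≔-lookup′ X i Xᵢ)))

  DownEdge⇒∣∣ : {X Z : V n} → DownEdge T X Z → ∣ X ∣ ≡ suc ∣ Z ∣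
  DownEdge⇒∣∣ {X} (i , down , refl) = ∣∣≡1+∣clear∣ X i (∧≡true⇒ˡ down)

  SimplePath-self : {X : V n} {vs : List (V n)} → SimplePath T X X vs → vs ≡ X ∷ []
  SimplePath-self {vs = x ∷ []}     (refl , _ , _ , _)        = refl
  SimplePath-self {vs = x ∷ y ∷ vs} (refl , l , _ , (x∉ ∷ _)) = ⊥-elim (All¬⇒¬Any x∉ (last∈ (y ∷ vs) l))

  SimplePath-tail : {X Y Z : V n} {vs : List (V n)} → SimplePath T X Y (X ∷ Z ∷ vs) → SimplePath T Z Y (Z ∷ vs)
  SimplePath-tail (refl , l , _ ∷ lk , _ ∷ u) = refl , l , lk , u

  SimplePath-suffix : {X Y W : V n} (pre post : List (V n)) →
                      SimplePath T X Y (pre ++ W ∷ post) → SimplePath T W Y (W ∷ post)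
  SimplePath-suffix pre post (_ , l , lk , u) =
    refl , trans (sym (last-++ pre _ post)) l , Linked-++⁻ʳ pre lk , Unique-++⁻ʳ pre u

  SimplePath-∷ : {W X Y : V n} {vs : List (V n)} → Adj T W X → W ∉ vs →
                 SimplePath T X Y vs → SimplePath T W Y (W ∷ vs)
  SimplePath-∷ {vs = x ∷ vs} adj W∉ (refl , l , lk , u) = refl , l , adj ∷ lk , ¬Any⇒All¬ _ W∉ ∷ u

  SimplePath-reverse : {X Y : V n} {vs : List (V n)} → SimplePath T X Y vs → SimplePath T Y X (reverse vs)
  SimplePath-reverse {vs = vs} (h , l , lk , u) =
    trans (head-reverse vs) l , trans (last-reverse vs) h , Linked-reverse Adj-sym lk , Unique-reverse u

-- Upright spanning trees are descent trees

module UprightSpanningTree {n : ℕ} {T : EdgeSet n} (spanning : IsSpanningTree T) (upright : Upright T) where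
  open Edges T

  down-edge-starts-root-path : {X : V n} (i : Fin n) → downEdge T i X ≡ true →
    Σ[ P ∈ List (V n) ] SimplePath T X (emptyV n) (X ∷ P) × head P ≡ just (X [ i ]≔ false)
  down-edge-starts-root-path {X} i down with (P , path) , _ ← spanning (X [ i ]≔ false) (emptyV n) =
    P , SimplePath-∷ (DownEdge⇒Adj (i , down , refl)) X∉P path , proj₁ path
    where
    X∉P : X ∉ P
    X∉P X∈P with pre , post , refl ← ∈-∃++ X∈P = 1+n≰n (begin
      suc ∣ X ∣                ≡⟨ upright X _ (SimplePath-suffix pre post path) ⟨
      length (X ∷ post)        ≤⟨ m≤n+m _ (length pre) ⟩
      length pre + length (X ∷ post) ≡⟨ length-++ pre ⟨
      length (pre ++ X ∷ post) ≡⟨ upright _ _ path ⟩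
      suc ∣ X [ i ]≔ false ∣   ≡⟨ ∣∣≡1+∣clear∣ X i (∧≡true⇒ˡ down) ⟨
      ∣ X ∣                    ∎)
      where open ≤-Reasoning

  down-edge-unique : {X : V n} (i j : Fin n) → downEdge T i X ≡ true → downEdge T j X ≡ true → i ≡ j
  down-edge-unique {X} i j downᵢ downⱼ with i Finₚ.≟ j
  ... | yes i≡j = i≡j
  ... | no i≢j
    with P , pathᵢ , headᵢ ← down-edge-starts-root-path i downᵢ
       | Q , pathⱼ , headⱼ ← down-edge-starts-root-path j downⱼ = contradiction (begin
      true                       ≡⟨ ∧≡true⇒ˡ downⱼ ⟨
      lookup X j                 ≡⟨ lookup∘update′ (i≢j ∘ sym) X false ⟨
      lookup (X [ i ]≔ false) j  ≡⟨ cong (λ Z → lookup Z j) same-parent ⟩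
      lookup (X [ j ]≔ false) j  ≡⟨ lookup∘update j X false ⟩
      false                      ∎) λ ()
    where
    open ≡-Reasoning
    P≡Q : P ≡ Q
    P≡Q = ∷-injectiveʳ (proj₂ (spanning X (emptyV n)) _ _ pathᵢ pathⱼ)
    same-parent : X [ i ]≔ false ≡ X [ j ]≔ false
    same-parent = just-injective (trans (sym headᵢ) (trans (cong head P≡Q) headⱼ))

  down-edge-exists : (X : V n) → nonempty X ≡ true → Σ[ i ∈ Fin n ] downEdge T i X ≡ true
  down-edge-exists X ne with (vs , path) , _ ← spanning X (emptyV n) = first-step vs path (upright X vs path)
    where
    first-step : (vs : List (V n)) → SimplePath T X (emptyV n) vs → length vs ≡ suc ∣ X ∣ →
                 Σ[ i ∈ Fin n ] downEdge T i X ≡ true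
    first-step (_ ∷ [])     _ len = ⊥-elim (nonempty⇒∣∣≢0 X ne (sym (suc-injective len)))
    first-step (_ ∷ Z ∷ vs) path@(refl , _ , adj ∷ _ , _) len with Adj⇒DownEdge adj
    ... | inj₁ (i , down , _) = i , down
    ... | inj₂ up = ⊥-elim (m≢1+n+m ∣ X ∣ (begin
      ∣ X ∣              ≡⟨ suc-injective len ⟨
      length (Z ∷ vs)    ≡⟨ upright Z (Z ∷ vs) (SimplePath-tail path) ⟩
      suc ∣ Z ∣          ≡⟨ cong suc (DownEdge⇒∣∣ up) ⟩
      suc (suc ∣ X ∣)    ∎))
      where open ≡-Reasoning

  downDegree≡ : (X : V n) → downDegree T X ≡ bit (nonempty X)
  downDegree≡ X with nonempty X in ne
  ... | false rewrite nonempty≡false⇒empty X ne = sum-bit≡0 _ downEdge-emptyV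
  ... | true with i , down ← down-edge-exists X ne =
    sum-bit≡1 _ i down (λ j downⱼ → down-edge-unique j i downⱼ down)

upright-spanning-tree⇒IsDescentTree : {n : ℕ} (T : EdgeSet n) →
  WellFormed T → IsSpanningTree T → Upright T → IsDescentTree T
upright-spanning-tree⇒IsDescentTree T wf spanning upright =
  wf , UprightSpanningTree.downDegree≡ {T = T} spanning upright

-- Descent trees are upright spanning trees

module DescentTree {n : ℕ} {T : EdgeSet n} (descent : IsDescentTree T) where
  open Edges T

  parent : V n → V n
  parent X with any? (λ i → downEdge T i X Boolₚ.≟ true)
  ... | yes (i , _) = X [ i ]≔ false
  ... | no _        = X

  downDegree≡1 : {X : V n} → nonempty X ≡ true → downDegree T X ≡ 1
  downDegree≡1 {X} ne = trans (proj₂ descent X) (cong bit ne)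

  DownEdge-parent : {X : V n} → nonempty X ≡ true → DownEdge T X (parent X)
  DownEdge-parent {X} ne with any? (λ i → downEdge T i X Boolₚ.≟ true)
  ... | yes (i , down) = i , down , refl
  ... | no no-down = contradiction
    (trans (sym (sum-bit≡0 _ (λ i → Boolₚ.¬-not (λ down → no-down (i , down))))) (downDegree≡1 ne)) λ ()

  DownEdge⇒parent : {X Z : V n} → DownEdge T X Z → Z ≡ parent X
  DownEdge⇒parent {X} (i , down , refl) with DownEdge-parent (lookup⇒nonempty X i (∧≡true⇒ˡ down))
  ... | j , downⱼ , parent≡ =
    trans (cong (λ k → X [ k ]≔ false) (sum-bit≡1⇒unique _ degree-one i j down downⱼ)) (sym parent≡)
    where
    degree-one : downDegree T X ≡ 1
    degree-one = downDegree≡1 (lookup⇒nonempty X i (∧≡true⇒ˡ down))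

  ∣∣≡1+∣parent∣ : {X : V n} → nonempty X ≡ true → ∣ X ∣ ≡ suc ∣ parent X ∣
  ∣∣≡1+∣parent∣ ne = DownEdge⇒∣∣ (DownEdge-parent ne)

  ∣parent∣≤∣∣ : (X : V n) → ∣ parent X ∣ ≤ ∣ X ∣
  ∣parent∣≤∣∣ X with any? (λ i → downEdge T i X Boolₚ.≟ true)
  ... | yes (i , _) = ∣clear∣≤∣∣ X i
  ... | no _        = ≤-refl

  ∣iterate-parent∣≤∣∣ : (k : ℕ) (X : V n) → ∣ iterate parent X k ∣ ≤ ∣ X ∣
  ∣iterate-parent∣≤∣∣ zero    X = ≤-refl
  ∣iterate-parent∣≤∣∣ (suc k) X = ≤-trans (∣iterate-parent∣≤∣∣ k (parent X)) (∣parent∣≤∣∣ X)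

  Descendant : V n → V n → Set
  Descendant W C = Σ[ k ∈ ℕ ] iterate parent W k ≡ C

  neighbour-below : {C W W′ : V n} → Adj T W W′ → Descendant W C → parent C ≢ W′ → Descendant W′ C
  neighbour-below {C} {W} {W′} adj below avoid = go (Adj⇒DownEdge adj) below
    where
    go : DownEdge T W W′ ⊎ DownEdge T W′ W → Descendant W C → Descendant W′ C
    go (inj₂ up)   (k , eq)     = suc k , trans (cong (λ U → iterate parent U k) (sym (DownEdge⇒parent up))) eq
    go (inj₁ down) (zero , eq)  = ⊥-elim (avoid (trans (cong parent (sym eq)) (sym (DownEdge⇒parent down))))
    go (inj₁ down) (suc k , eq) = k , trans (cong (λ U → iterate parent U k) (DownEdge⇒parent down)) eq

  walk-stays-below : (C W : V n) (vs : List (V n)) → Linked (Adj T) (W ∷ vs) → Descendant W C →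
                     All (parent C ≢_) vs → All (λ U → Descendant U C) (W ∷ vs)
  walk-stays-below C W []        _          below _                = below ∷ []
  walk-stays-below C W (W′ ∷ vs) (adj ∷ lk) below (avoid ∷ avoids) =
    below ∷ walk-stays-below C W′ vs lk (neighbour-below adj below avoid) avoids

  -- A first step to a child Z of X would trap the rest of the path among the descendants of Z,
  -- all of which are larger than X.
  first-step-to-parent : {X Y Z : V n} {vs : List (V n)} → SimplePath T X Y (X ∷ Z ∷ vs) → ∣ Y ∣ ≤ ∣ X ∣ →
                         Z ≡ parent X
  first-step-to-parent {X} {Y} {Z} {vs} (_ , l , adj ∷ lk , (_ ∷ X∉vs) ∷ _) Y≤X with Adj⇒DownEdge adj
  ... | inj₁ down = DownEdge⇒parent down
  ... | inj₂ up
    with k , eq ← All.lookup (walk-stays-below Z Z vs lk (0 , refl)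
                                (subst (λ P → All (P ≢_) vs) (DownEdge⇒parent up) X∉vs))
                             (last∈ (Z ∷ vs) l) =
    ⊥-elim (1+n≰n (begin
      suc ∣ X ∣              ≡⟨ DownEdge⇒∣∣ up ⟨
      ∣ Z ∣                  ≡⟨ cong ∣_∣ eq ⟨
      ∣ iterate parent Y k ∣ ≤⟨ ∣iterate-parent∣≤∣∣ k Y ⟩
      ∣ Y ∣                  ≤⟨ Y≤X ⟩
      ∣ X ∣                  ∎))
    where open ≤-Reasoning

  UniquePaths : V n → V n → Set
  UniquePaths X Y = {p q : List (V n)} → SimplePath T X Y p → SimplePath T X Y q → p ≡ q

  unique-paths-self : {X : V n} → UniquePaths X X
  unique-paths-self p q = trans (SimplePath-self p) (sym (SimplePath-self q))

  unique-paths-reverse : {X Y : V n} → UniquePaths Y X → UniquePaths X Y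
  unique-paths-reverse unique p q = reverse-injective (unique (SimplePath-reverse p) (SimplePath-reverse q))

  unique-paths-via-parent : {X Y : V n} → X ≢ Y → ∣ Y ∣ ≤ ∣ X ∣ → UniquePaths (parent X) Y → UniquePaths X Y
  unique-paths-via-parent X≢Y _ _ {_ ∷ []} (refl , l , _) _ = ⊥-elim (X≢Y (just-injective l))
  unique-paths-via-parent X≢Y _ _ {_ ∷ _ ∷ _} {_ ∷ []} _ (refl , l , _) = ⊥-elim (X≢Y (just-injective l))
  unique-paths-via-parent X≢Y Y≤X unique {X ∷ _ ∷ _} {_ ∷ _ ∷ _} p@(refl , _) q@(refl , _)
    with refl ← first-step-to-parent p Y≤X | refl ← first-step-to-parent q Y≤X =
    cong (X ∷_) (unique (SimplePath-tail p) (SimplePath-tail q))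

  parent-shrinks : {X Y : V n} → X ≢ Y → ∣ Y ∣ ≤ ∣ X ∣ → ∣ parent X ∣ + ∣ Y ∣ < ∣ X ∣ + ∣ Y ∣
  parent-shrinks {X} {Y} X≢Y Y≤X =
    subst (λ s → ∣ parent X ∣ + ∣ Y ∣ < s + ∣ Y ∣)
          (sym (∣∣≡1+∣parent∣ (≢-smaller⇒nonempty X≢Y Y≤X))) ≤-refl

  unique-paths-below : (k : ℕ) (X Y : V n) → ∣ X ∣ + ∣ Y ∣ < k → UniquePaths X Y
  unique-paths-below (suc k) X Y (s≤s size) with X ≟V Y | ∣ Y ∣ ≤? ∣ X ∣
  ... | yes refl | _      = unique-paths-self
  ... | no X≢Y  | yes Y≤X =
    unique-paths-via-parent X≢Y Y≤X (unique-paths-below k (parent X) Y (<-≤-trans (parent-shrinks X≢Y Y≤X) size))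
  ... | no X≢Y  | no Y≰X  =
    unique-paths-reverse (unique-paths-via-parent (X≢Y ∘ sym) X≤Y
      (unique-paths-below k (parent Y) X
        (<-≤-trans (parent-shrinks (X≢Y ∘ sym) X≤Y) (subst (_≤ k) (+-comm ∣ X ∣ ∣ Y ∣) size))))
    where
    X≤Y : ∣ X ∣ ≤ ∣ Y ∣
    X≤Y = <⇒≤ (≰⇒> Y≰X)

  paths-unique : (X Y : V n) → UniquePaths X Y
  paths-unique X Y = unique-paths-below (suc (∣ X ∣ + ∣ Y ∣)) X Y ≤-refl

  root-path-length : {X : V n} (vs : List (V n)) → SimplePath T X (emptyV n) vs → length vs ≡ suc ∣ X ∣
  root-path-length (_ ∷ [])     (refl , l , _) = cong suc (sym (trans (cong ∣_∣ (just-injective l)) (∣⊥∣≡0 n)))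
  root-path-length {X} (_ ∷ Z ∷ vs) path@(refl , _) = begin
      suc (length (Z ∷ vs))   ≡⟨ cong suc (root-path-length (Z ∷ vs) (SimplePath-tail path)) ⟩
      suc (suc ∣ Z ∣)         ≡⟨ cong (λ W → suc (suc ∣ W ∣)) (first-step-to-parent path (∣emptyV∣≤∣∣ X)) ⟩
      suc (suc ∣ parent X ∣)  ≡⟨ cong suc (∣∣≡1+∣parent∣ (≢-smaller⇒nonempty X≢∅ (∣emptyV∣≤∣∣ X))) ⟨
      suc ∣ X ∣               ∎
    where
    open ≡-Reasoning
    X≢∅ : X ≢ emptyV n
    X≢∅ X≡∅ with () ← SimplePath-self (subst (λ W → SimplePath T W (emptyV n) (X ∷ Z ∷ vs)) X≡∅ path)

  ∣parent∣≡ : {X : V n} {k : ℕ} → ∣ X ∣ ≡ suc k → ∣ parent X ∣ ≡ k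
  ∣parent∣≡ {X} size = suc-injective (trans (sym (∣∣≡1+∣parent∣ (∣∣≡suc⇒nonempty X size))) size)

  ancestors-linked : (k : ℕ) (X : V n) → ∣ X ∣ ≡ k → Linked (Adj T) (List.iterate parent X (suc k))
  ancestors-linked zero    X _    = [-]
  ancestors-linked (suc k) X size =
    DownEdge⇒Adj (DownEdge-parent (∣∣≡suc⇒nonempty X size)) ∷ ancestors-linked k (parent X) (∣parent∣≡ size)

  ancestors-last : (k : ℕ) (X : V n) → ∣ X ∣ ≡ k → last (List.iterate parent X (suc k)) ≡ just (emptyV n)
  ancestors-last zero    X size = cong just (∣∣≡0⇒empty X size)
  ancestors-last (suc k) X size = ancestors-last k (parent X) (∣parent∣≡ size)

  ancestors : V n → List (V n)
  ancestors X = List.iterate parent X (suc ∣ X ∣)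

  walk-through-root : (X Y : V n) → Linked (ReflClosure (Adj T)) (ancestors X ++ reverse (ancestors Y))
  walk-through-root X Y =
    Linkedₚ.++⁺ (Linked.map [_] (ancestors-linked _ X refl)) meet
                (Linked.map [_] (Linked-reverse Adj-sym (ancestors-linked _ Y refl)))
    where
    meet : Connected (ReflClosure (Adj T)) (last (ancestors X)) (head (reverse (ancestors Y)))
    meet = subst₂ (Connected _) (sym (ancestors-last _ X refl))
             (sym (trans (head-reverse (ancestors Y)) (ancestors-last _ Y refl))) (Connected.just Refl.refl)

  path-exists : (X Y : V n) → Σ (List (V n)) (SimplePath T X Y)
  path-exists X Y =
    let vs , lk , u , h , l = loop-erase _≟V_ (ancestors X ++ reverse (ancestors Y)) (walk-through-root X Y)
    in vs , h , trans l (last-++-just (ancestors X) (last-reverse (ancestors Y))) , lk , u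

IsDescentTree⇒upright-spanning-tree : {n : ℕ} (T : EdgeSet n) → IsDescentTree T → IsSpanningTree T × Upright T
IsDescentTree⇒upright-spanning-tree T descent =
  (λ X Y → path-exists X Y , λ p q → paths-unique X Y) , λ X → root-path-length
  where open DescentTree {T = T} descent

Tab-ext : {n : ℕ} {t u : Tab n} → (∀ X → lookupTab t X ≡ lookupTab u X) → t ≡ u
Tab-ext {zero}  eq = eq []
Tab-ext {suc n} eq = cong₂ _,_ (Tab-ext (eq ∘ (false ∷_))) (Tab-ext (eq ∘ (true ∷_)))

∑V : {n : ℕ} → (V n → ℕ) → ℕ
∑V {zero}  f = f []
∑V {suc n} f = ∑V (f ∘ (false ∷_)) + ∑V (f ∘ (true ∷_))

∑V-cong : {n : ℕ} {f g : V n → ℕ} → (∀ X → f X ≡ g X) → ∑V f ≡ ∑V g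
∑V-cong {zero}  eq = eq []
∑V-cong {suc n} eq = cong₂ _+_ (∑V-cong (eq ∘ (false ∷_))) (∑V-cong (eq ∘ (true ∷_)))

∑V-zero : (n : ℕ) → ∑V {n} (λ _ → 0) ≡ 0
∑V-zero zero    = refl
∑V-zero (suc n) = cong₂ _+_ (∑V-zero n) (∑V-zero n)

∑V-+ : {n : ℕ} (f g : V n → ℕ) → ∑V (λ X → f X + g X) ≡ ∑V f + ∑V g
∑V-+ {zero}  f g = refl
∑V-+ {suc n} f g =
  trans (cong₂ _+_ (∑V-+ (f ∘ (false ∷_)) (g ∘ (false ∷_))) (∑V-+ (f ∘ (true ∷_)) (g ∘ (true ∷_))))
        (interchange (∑V (f ∘ (false ∷_))) _ _ _)

∑V≡0⇒≡0 : {n : ℕ} (f : V n → ℕ) → ∑V f ≡ 0 → ∀ X → f X ≡ 0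
∑V≡0⇒≡0 {zero}  f eq []          = eq
∑V≡0⇒≡0 {suc n} f eq (false ∷ X) = ∑V≡0⇒≡0 _ (m+n≡0⇒m≡0 _ eq) X
∑V≡0⇒≡0 {suc n} f eq (true ∷ X)  = ∑V≡0⇒≡0 _ (m+n≡0⇒n≡0 (∑V (f ∘ (false ∷_))) eq) X

∑V-one : (n : ℕ) → ∑V {n} (λ _ → 1) ≡ 2 ^ n
∑V-one zero    = refl
∑V-one (suc n) = begin
  ∑V {n} (λ _ → 1) + ∑V {n} (λ _ → 1) ≡⟨ cong₂ _+_ (∑V-one n) (∑V-one n) ⟩
  2 ^ n + 2 ^ n                       ≡⟨ cong (2 ^ n +_) (+-identityʳ _) ⟨
  2 ^ suc n                           ∎
  where open ≡-Reasoning

∑V-nonempty : (n : ℕ) → ∑V {n} (bit ∘ nonempty) + 1 ≡ 2 ^ n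
∑V-nonempty zero    = refl
∑V-nonempty (suc n) = begin
  ∑V {n} (bit ∘ nonempty) + ∑V {n} (λ _ → 1) + 1 ≡⟨ xy∙z≈xz∙y (∑V {n} (bit ∘ nonempty)) _ 1 ⟩
  ∑V {n} (bit ∘ nonempty) + 1 + ∑V {n} (λ _ → 1) ≡⟨ cong₂ _+_ (∑V-nonempty n) (∑V-one n) ⟩
  2 ^ n + 2 ^ n                                    ≡⟨ cong (2 ^ n +_) (+-identityʳ _) ⟨
  2 ^ suc n                                        ∎
  where open ≡-Reasoning

∑V-sum-comm : {n m : ℕ} (g : Fin m → V n → ℕ) → ∑V (λ X → sum (λ i → g i X)) ≡ sum (λ i → ∑V (g i))
∑V-sum-comm {n} {zero}  g = ∑V-zero n
∑V-sum-comm {n} {suc m} g =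
  trans (∑V-+ (g zero) (λ X → sum (λ i → g (suc i) X))) (cong (∑V (g zero) +_) (∑V-sum-comm (g ∘ suc)))

countTab≡∑V : {n : ℕ} (t : Tab n) → countTab t ≡ ∑V (bit ∘ lookupTab t)
countTab≡∑V {zero}  false   = refl
countTab≡∑V {zero}  true    = refl
countTab≡∑V {suc n} (f , t) = cong₂ _+_ (countTab≡∑V f) (countTab≡∑V t)

∑V-by-upper-endpoint : {n : ℕ} (i : Fin n) (g : V n → Bool) → (∀ X → lookup X i ≡ true → g X ≡ false) →
  ∑V (bit ∘ g) ≡ ∑V (λ X → bit (lookup X i ∧ g (X [ i ]≔ false)))
∑V-by-upper-endpoint {suc n} zero g vanishes = begin
  ∑V (bit ∘ g ∘ (false ∷_)) + ∑V (bit ∘ g ∘ (true ∷_)) ≡⟨ cong (∑V (bit ∘ g ∘ (false ∷_)) +_) upper-half ⟩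
  ∑V (bit ∘ g ∘ (false ∷_)) + 0                         ≡⟨ +-comm _ 0 ⟩
  0 + ∑V (bit ∘ g ∘ (false ∷_))                         ≡⟨ cong (_+ ∑V (bit ∘ g ∘ (false ∷_))) (∑V-zero n) ⟨
  ∑V {n} (λ _ → 0) + ∑V (bit ∘ g ∘ (false ∷_))          ∎
  where
  open ≡-Reasoning
  upper-half : ∑V (bit ∘ g ∘ (true ∷_)) ≡ 0
  upper-half = trans (∑V-cong (λ X → cong bit (vanishes (true ∷ X) refl))) (∑V-zero n)
∑V-by-upper-endpoint {suc n} (suc i) g vanishes =
  cong₂ _+_ (∑V-by-upper-endpoint i (g ∘ (false ∷_)) (vanishes ∘ (false ∷_)))
            (∑V-by-upper-endpoint i (g ∘ (true ∷_)) (vanishes ∘ (true ∷_)))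

∑V-∷ʳ : {n : ℕ} (f : V (suc n) → ℕ) → ∑V f ≡ ∑V (λ Y → f (Y ∷ʳ false)) + ∑V (λ Y → f (Y ∷ʳ true))
∑V-∷ʳ {zero}  f = refl
∑V-∷ʳ {suc n} f =
  trans (cong₂ _+_ (∑V-∷ʳ (f ∘ (false ∷_))) (∑V-∷ʳ (f ∘ (true ∷_))))
        (interchange (∑V (λ Y → f (false ∷ (Y ∷ʳ false)))) _ _ _)

countTab≡∑V-downEdge : {n : ℕ} {T : EdgeSet n} → WellFormed T → (i : Fin n) →
                       countTab (lookup T i) ≡ ∑V (bit ∘ downEdge T i)
countTab≡∑V-downEdge {T = T} wf i = trans (countTab≡∑V (lookup T i)) (∑V-by-upper-endpoint i _ (wf i))

-- Adding a new last direction

module _ {A : Set} where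

  lookup-∷ʳ-inject₁ : {m : ℕ} (v : Vec A m) (x : A) (j : Fin m) → lookup (v ∷ʳ x) (inject₁ j) ≡ lookup v j
  lookup-∷ʳ-inject₁ (y ∷ v) x zero    = refl
  lookup-∷ʳ-inject₁ (y ∷ v) x (suc j) = lookup-∷ʳ-inject₁ v x j

  lookup-∷ʳ-fromℕ : {m : ℕ} (v : Vec A m) (x : A) → lookup (v ∷ʳ x) (fromℕ m) ≡ x
  lookup-∷ʳ-fromℕ []      x = refl
  lookup-∷ʳ-fromℕ (y ∷ v) x = lookup-∷ʳ-fromℕ v x

  []≔-∷ʳ-inject₁ : {m : ℕ} (v : Vec A m) (x : A) (j : Fin m) (y : A) →
                   (v ∷ʳ x) [ inject₁ j ]≔ y ≡ (v [ j ]≔ y) ∷ʳ x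
  []≔-∷ʳ-inject₁ (z ∷ v) x zero    y = refl
  []≔-∷ʳ-inject₁ (z ∷ v) x (suc j) y = cong (z ∷_) ([]≔-∷ʳ-inject₁ v x j y)

  []≔-∷ʳ-fromℕ : {m : ℕ} (v : Vec A m) (x y : A) → (v ∷ʳ x) [ fromℕ m ]≔ y ≡ v ∷ʳ y
  []≔-∷ʳ-fromℕ []      x y = refl
  []≔-∷ʳ-fromℕ (z ∷ v) x y = cong (z ∷_) ([]≔-∷ʳ-fromℕ v x y)

  ≗-lookup⇒≡ : {m : ℕ} {u v : Vec A m} → (∀ i → lookup u i ≡ lookup v i) → u ≡ v
  ≗-lookup⇒≡ {u = u} {v} eq = trans (sym (tabulate∘lookup u)) (trans (tabulate-cong eq) (tabulate∘lookup v))

data Direction (m : ℕ) : Fin (suc m) → Set where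
  old : (j : Fin m) → Direction m (inject₁ j)
  new : Direction m (fromℕ m)

direction : {m : ℕ} (i : Fin (suc m)) → Direction m i
direction {zero}  zero    = new
direction {suc m} zero    = old zero
direction {suc m} (suc i) with direction i
... | old j = old (suc j)
... | new   = new

∀-∷ʳ : {m : ℕ} {P : V (suc m) → Set} → (∀ Y b → P (Y ∷ʳ b)) → ∀ X → P X
∀-∷ʳ h X with Y , b , refl ← initLast X = h Y b

nonempty-∷ʳ-false : {m : ℕ} (Y : V m) → nonempty (Y ∷ʳ false) ≡ nonempty Y
nonempty-∷ʳ-false []      = refl
nonempty-∷ʳ-false (y ∷ Y) = cong (y ∨_) (nonempty-∷ʳ-false Y)

nonempty-∷ʳ-true : {m : ℕ} (Y : V m) → nonempty (Y ∷ʳ true) ≡ true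
nonempty-∷ʳ-true []      = refl
nonempty-∷ʳ-true (y ∷ Y) = trans (cong (y ∨_) (nonempty-∷ʳ-true Y)) (Boolₚ.∨-zeroʳ y)

-- The last coordinate is the innermost level of a Tab, so these operations act at its leaves.

liftTab : {m : ℕ} → Tab m → Tab (suc m)
liftTab {zero}  b       = b , false
liftTab {suc m} (f , t) = liftTab f , liftTab t

fullTab : (m : ℕ) → Tab (suc m)
fullTab zero    = true , false
fullTab (suc m) = fullTab m , fullTab m

bottomTab : {m : ℕ} → Tab (suc m) → Tab m
bottomTab {zero}  (f , _) = f
bottomTab {suc m} (f , t) = bottomTab f , bottomTab t

lookupTab-liftTab : {m : ℕ} (t : Tab m) (Y : V m) (b : Bool) → lookupTab (liftTab t) (Y ∷ʳ b) ≡ not b ∧ lookupTab t Y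
lookupTab-liftTab {zero}  t       []          false = refl
lookupTab-liftTab {zero}  t       []          true  = refl
lookupTab-liftTab {suc m} (f , t) (false ∷ Y) b     = lookupTab-liftTab f Y b
lookupTab-liftTab {suc m} (f , t) (true ∷ Y)  b     = lookupTab-liftTab t Y b

lookupTab-fullTab : (m : ℕ) (Y : V m) (b : Bool) → lookupTab (fullTab m) (Y ∷ʳ b) ≡ not b
lookupTab-fullTab zero    []          false = refl
lookupTab-fullTab zero    []          true  = refl
lookupTab-fullTab (suc m) (false ∷ Y) b     = lookupTab-fullTab m Y b
lookupTab-fullTab (suc m) (true ∷ Y)  b     = lookupTab-fullTab m Y b

lookupTab-bottomTab : {m : ℕ} (t : Tab (suc m)) (Y : V m) → lookupTab (bottomTab t) Y ≡ lookupTab t (Y ∷ʳ false)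
lookupTab-bottomTab {zero}  (f , t) []          = refl
lookupTab-bottomTab {suc m} (f , t) (false ∷ Y) = lookupTab-bottomTab f Y
lookupTab-bottomTab {suc m} (f , t) (true ∷ Y)  = lookupTab-bottomTab t Y

countTab-liftTab : {m : ℕ} (t : Tab m) → countTab (liftTab t) ≡ countTab t
countTab-liftTab {zero}  b       = +-identityʳ _
countTab-liftTab {suc m} (f , t) = cong₂ _+_ (countTab-liftTab f) (countTab-liftTab t)

countTab-fullTab : (m : ℕ) → countTab (fullTab m) ≡ 2 ^ m
countTab-fullTab zero    = refl
countTab-fullTab (suc m) = begin
  countTab (fullTab m) + countTab (fullTab m) ≡⟨ cong₂ _+_ (countTab-fullTab m) (countTab-fullTab m) ⟩
  2 ^ m + 2 ^ m                               ≡⟨ cong (2 ^ m +_) (+-identityʳ _) ⟨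
  2 ^ suc m                                   ∎
  where open ≡-Reasoning

bottomTab-liftTab : {m : ℕ} (t : Tab m) → bottomTab (liftTab t) ≡ t
bottomTab-liftTab {zero}  b       = refl
bottomTab-liftTab {suc m} (f , t) = cong₂ _,_ (bottomTab-liftTab f) (bottomTab-liftTab t)

liftTab-bottomTab : {m : ℕ} (t : Tab (suc m)) → (∀ Y → lookupTab t (Y ∷ʳ true) ≡ false) → liftTab (bottomTab t) ≡ t
liftTab-bottomTab t top-empty = Tab-ext (∀-∷ʳ λ where
  Y false → trans (lookupTab-liftTab (bottomTab t) Y false) (lookupTab-bottomTab t Y)
  Y true  → trans (lookupTab-liftTab (bottomTab t) Y true) (sym (top-empty Y)))

fullTab-unique : {m : ℕ} (t : Tab (suc m)) → (∀ Y b → lookupTab t (Y ∷ʳ b) ≡ not b) → fullTab m ≡ t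
fullTab-unique {m} t eq = Tab-ext (∀-∷ʳ λ Y b → trans (lookupTab-fullTab m Y b) (sym (eq Y b)))

module _ {m : ℕ} where

  lift : EdgeSet m → EdgeSet (suc m)
  lift T = Vec.map liftTab T ∷ʳ fullTab m

  restrict : EdgeSet (suc m) → EdgeSet m
  restrict T = tabulate (bottomTab ∘ lookup T ∘ inject₁)

  lookup-lift-old : (T : EdgeSet m) (j : Fin m) → lookup (lift T) (inject₁ j) ≡ liftTab (lookup T j)
  lookup-lift-old T j = trans (lookup-∷ʳ-inject₁ (Vec.map liftTab T) (fullTab m) j) (lookup-map j liftTab T)

  lookup-lift-new : (T : EdgeSet m) → lookup (lift T) (fromℕ m) ≡ fullTab m
  lookup-lift-new T = lookup-∷ʳ-fromℕ (Vec.map liftTab T) (fullTab m)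

  lookupTab-lift-old : (T : EdgeSet m) (j : Fin m) (Y : V m) (b : Bool) →
    lookupTab (lookup (lift T) (inject₁ j)) (Y ∷ʳ b) ≡ not b ∧ lookupTab (lookup T j) Y
  lookupTab-lift-old T j Y b =
    trans (cong (λ t → lookupTab t (Y ∷ʳ b)) (lookup-lift-old T j)) (lookupTab-liftTab (lookup T j) Y b)

  lookupTab-lift-new : (T : EdgeSet m) (Y : V m) (b : Bool) → lookupTab (lookup (lift T) (fromℕ m)) (Y ∷ʳ b) ≡ not b
  lookupTab-lift-new T Y b = trans (cong (λ t → lookupTab t (Y ∷ʳ b)) (lookup-lift-new T)) (lookupTab-fullTab m Y b)

  restrict-lift : (T : EdgeSet m) → restrict (lift T) ≡ T
  restrict-lift T =
    trans (tabulate-cong λ j → trans (cong bottomTab (lookup-lift-old T j)) (bottomTab-liftTab (lookup T j)))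
          (tabulate∘lookup T)

  signature-lift : (T : EdgeSet m) → signature (lift T) ≡ signature T ∷ʳ 2 ^ m
  signature-lift T = begin
    Vec.map countTab (Vec.map liftTab T ∷ʳ fullTab m)        ≡⟨ map-∷ʳ countTab (fullTab m) (Vec.map liftTab T) ⟩
    Vec.map countTab (Vec.map liftTab T) ∷ʳ countTab (fullTab m)
      ≡⟨ cong₂ _∷ʳ_ (trans (sym (map-∘ countTab liftTab T)) (map-cong countTab-liftTab T)) (countTab-fullTab m) ⟩
    Vec.map countTab T ∷ʳ 2 ^ m                              ∎
    where open ≡-Reasoning

  downEdge-∷ʳ-old : (T : EdgeSet (suc m)) (j : Fin m) (Y : V m) (b : Bool) →
    downEdge T (inject₁ j) (Y ∷ʳ b) ≡ lookup Y j ∧ lookupTab (lookup T (inject₁ j)) ((Y [ j ]≔ false) ∷ʳ b)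
  downEdge-∷ʳ-old T j Y b =
    cong₂ _∧_ (lookup-∷ʳ-inject₁ Y b j)
              (cong (lookupTab (lookup T (inject₁ j))) ([]≔-∷ʳ-inject₁ Y b j false))

  downEdge-∷ʳ-new : (T : EdgeSet (suc m)) (Y : V m) (b : Bool) →
    downEdge T (fromℕ m) (Y ∷ʳ b) ≡ b ∧ lookupTab (lookup T (fromℕ m)) (Y ∷ʳ false)
  downEdge-∷ʳ-new T Y b =
    cong₂ _∧_ (lookup-∷ʳ-fromℕ Y b) (cong (lookupTab (lookup T (fromℕ m))) ([]≔-∷ʳ-fromℕ Y b false))

  oldDegree : EdgeSet (suc m) → V (suc m) → ℕ
  oldDegree T X = sum (λ j → bit (downEdge T (inject₁ j) X))

  downDegree-split : (T : EdgeSet (suc m)) (X : V (suc m)) →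
    downDegree T X ≡ oldDegree T X + bit (downEdge T (fromℕ m) X)
  downDegree-split T X = sum-init-last (λ i → bit (downEdge T i X))

  downDegree-bottom : (T : EdgeSet (suc m)) (Y : V m) → downDegree T (Y ∷ʳ false) ≡ oldDegree T (Y ∷ʳ false)
  downDegree-bottom T Y = begin
    downDegree T (Y ∷ʳ false)                                           ≡⟨ downDegree-split T (Y ∷ʳ false) ⟩
    oldDegree T (Y ∷ʳ false) + bit (downEdge T (fromℕ m) (Y ∷ʳ false))
      ≡⟨ cong (λ b → oldDegree T (Y ∷ʳ false) + bit b) (downEdge-∷ʳ-new T Y false) ⟩
    oldDegree T (Y ∷ʳ false) + 0                                        ≡⟨ +-identityʳ _ ⟩
    oldDegree T (Y ∷ʳ false)                                            ∎
    where open ≡-Reasoning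

  downDegree-top : (T : EdgeSet (suc m)) (Y : V m) →
    downDegree T (Y ∷ʳ true) ≡ oldDegree T (Y ∷ʳ true) + bit (lookupTab (lookup T (fromℕ m)) (Y ∷ʳ false))
  downDegree-top T Y =
    trans (downDegree-split T (Y ∷ʳ true)) (cong (λ b → oldDegree T (Y ∷ʳ true) + bit b) (downEdge-∷ʳ-new T Y true))

  downEdge-lift-old : (T : EdgeSet m) (j : Fin m) (Y : V m) (b : Bool) →
    downEdge (lift T) (inject₁ j) (Y ∷ʳ b) ≡ not b ∧ downEdge T j Y
  downEdge-lift-old T j Y b = begin
    downEdge (lift T) (inject₁ j) (Y ∷ʳ b)                            ≡⟨ downEdge-∷ʳ-old (lift T) j Y b ⟩
    lookup Y j ∧ lookupTab (lookup (lift T) (inject₁ j)) ((Y [ j ]≔ false) ∷ʳ b)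
      ≡⟨ cong (lookup Y j ∧_) (lookupTab-lift-old T j (Y [ j ]≔ false) b) ⟩
    lookup Y j ∧ (not b ∧ lookupTab (lookup T j) (Y [ j ]≔ false))  ≡⟨ Boolₚ.∧-assoc (lookup Y j) (not b) _ ⟨
    (lookup Y j ∧ not b) ∧ lookupTab (lookup T j) (Y [ j ]≔ false)  ≡⟨ cong (_∧ _) (Boolₚ.∧-comm (lookup Y j) (not b)) ⟩
    (not b ∧ lookup Y j) ∧ lookupTab (lookup T j) (Y [ j ]≔ false)  ≡⟨ Boolₚ.∧-assoc (not b) (lookup Y j) _ ⟩
    not b ∧ downEdge T j Y                                            ∎
    where open ≡-Reasoning

  downEdge-lift-new : (T : EdgeSet m) (Y : V m) (b : Bool) → downEdge (lift T) (fromℕ m) (Y ∷ʳ b) ≡ b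
  downEdge-lift-new T Y b =
    trans (downEdge-∷ʳ-new (lift T) Y b) (trans (cong (b ∧_) (lookupTab-lift-new T Y false)) (Boolₚ.∧-identityʳ b))

  downDegree-lift-bottom : (T : EdgeSet m) (Y : V m) → downDegree (lift T) (Y ∷ʳ false) ≡ downDegree T Y
  downDegree-lift-bottom T Y = begin
    downDegree (lift T) (Y ∷ʳ false)                        ≡⟨ downDegree-split (lift T) (Y ∷ʳ false) ⟩
    oldDegree (lift T) (Y ∷ʳ false) + bit (downEdge (lift T) (fromℕ m) (Y ∷ʳ false))
      ≡⟨ cong₂ _+_ (sum-cong-≗ (cong bit ∘ λ j → downEdge-lift-old T j Y false))
                   (cong bit (downEdge-lift-new T Y false)) ⟩
    downDegree T Y + 0                                      ≡⟨ +-identityʳ _ ⟩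
    downDegree T Y                                          ∎
    where open ≡-Reasoning

  downDegree-lift-top : (T : EdgeSet m) (Y : V m) → downDegree (lift T) (Y ∷ʳ true) ≡ 1
  downDegree-lift-top T Y = begin
    downDegree (lift T) (Y ∷ʳ true)                         ≡⟨ downDegree-split (lift T) (Y ∷ʳ true) ⟩
    oldDegree (lift T) (Y ∷ʳ true) + bit (downEdge (lift T) (fromℕ m) (Y ∷ʳ true))
      ≡⟨ cong₂ _+_ (sum-bit≡0 _ (λ j → downEdge-lift-old T j Y true)) (cong bit (downEdge-lift-new T Y true)) ⟩
    1                                                       ∎
    where open ≡-Reasoning

  lift-WellFormed : (T : EdgeSet m) → WellFormed T → WellFormed (lift T)
  lift-WellFormed T wf i = ∀-∷ʳ (go (direction i))
    where
    go : Direction m i → ∀ Y b → lookup (Y ∷ʳ b) i ≡ true → lookupTab (lookup (lift T) i) (Y ∷ʳ b) ≡ false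
    go (old j) Y b Xᵢ = trans (lookupTab-lift-old T j Y b)
      (trans (cong (not b ∧_) (wf j Y (trans (sym (lookup-∷ʳ-inject₁ Y b j)) Xᵢ))) (Boolₚ.∧-zeroʳ (not b)))
    go new     Y b Xᵢ = trans (lookupTab-lift-new T Y b) (cong not (trans (sym (lookup-∷ʳ-fromℕ Y b)) Xᵢ))

  WellFormed-of-lift : (T : EdgeSet m) → WellFormed (lift T) → WellFormed T
  WellFormed-of-lift T wf j Y Yⱼ =
    trans (sym (lookupTab-lift-old T j Y false))
          (wf (inject₁ j) (Y ∷ʳ false) (trans (lookup-∷ʳ-inject₁ Y false j) Yⱼ))

  lift-IsDescentTree : (T : EdgeSet m) → IsDescentTree T → IsDescentTree (lift T)
  lift-IsDescentTree T (wf , degree) = lift-WellFormed T wf , ∀-∷ʳ λ where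
    Y false → trans (downDegree-lift-bottom T Y) (trans (degree Y) (cong bit (sym (nonempty-∷ʳ-false Y))))
    Y true  → trans (downDegree-lift-top T Y) (cong bit (sym (nonempty-∷ʳ-true Y)))

  IsDescentTree-of-lift : (T : EdgeSet m) → IsDescentTree (lift T) → IsDescentTree T
  IsDescentTree-of-lift T (wf , degree) = WellFormed-of-lift T wf , λ Y →
    trans (sym (downDegree-lift-bottom T Y)) (trans (degree (Y ∷ʳ false)) (cong bit (nonempty-∷ʳ-false Y)))

-- Saturated directions

prefixSum≡sum : {m : ℕ} (S : Vec ℕ m) → prefixSum S m ≡ sum (lookup S)
prefixSum≡sum []      = refl
prefixSum≡sum (x ∷ S) = cong (x +_) (prefixSum≡sum S)

prefixSum-∷ʳ-≤ : {m : ℕ} (S : Vec ℕ m) (a k : ℕ) → k ≤ m → prefixSum (S ∷ʳ a) k ≡ prefixSum S k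
prefixSum-∷ʳ-≤ S       a zero    _         = refl
prefixSum-∷ʳ-≤ (x ∷ S) a (suc k) (s≤s k≤m) = cong (x +_) (prefixSum-∷ʳ-≤ S a k k≤m)

prefixSum-∷ʳ : {m : ℕ} (S : Vec ℕ m) (a : ℕ) → prefixSum (S ∷ʳ a) (suc m) ≡ prefixSum S m + a
prefixSum-∷ʳ []      a = +-identityʳ a
prefixSum-∷ʳ (x ∷ S) a = trans (cong (x +_) (prefixSum-∷ʳ S a)) (sym (+-assoc x _ a))

module Saturated {m : ℕ} {T : EdgeSet (suc m)} (descent : IsDescentTree T) {S : Vec ℕ m} {a : ℕ}
                 (sig : signature T ≡ S ∷ʳ a) (saturated : prefixSum S m + 1 ≡ 2 ^ m) where

  open ≡-Reasoning

  nonempties topDegrees : ℕ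
  nonempties = ∑V {m} (bit ∘ nonempty)
  topDegrees = ∑V (λ Y → oldDegree T (Y ∷ʳ true))

  oldDegree-bottom : (Y : V m) → oldDegree T (Y ∷ʳ false) ≡ bit (nonempty Y)
  oldDegree-bottom Y = begin
    oldDegree T (Y ∷ʳ false)     ≡⟨ downDegree-bottom T Y ⟨
    downDegree T (Y ∷ʳ false)    ≡⟨ proj₂ descent (Y ∷ʳ false) ⟩
    bit (nonempty (Y ∷ʳ false))  ≡⟨ cong bit (nonempty-∷ʳ-false Y) ⟩
    bit (nonempty Y)             ∎

  old-signature : (j : Fin m) → lookup S j ≡ ∑V (bit ∘ downEdge T (inject₁ j))
  old-signature j = begin
    lookup S j                               ≡⟨ lookup-∷ʳ-inject₁ S a j ⟨
    lookup (S ∷ʳ a) (inject₁ j)              ≡⟨ cong (λ v → lookup v (inject₁ j)) sig ⟨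
    lookup (signature T) (inject₁ j)         ≡⟨ lookup-map (inject₁ j) countTab T ⟩
    countTab (lookup T (inject₁ j))          ≡⟨ countTab≡∑V-downEdge {T = T} (proj₁ descent) (inject₁ j) ⟩
    ∑V (bit ∘ downEdge T (inject₁ j))        ∎

  prefixSum≡degrees : prefixSum S m ≡ nonempties + topDegrees
  prefixSum≡degrees = begin
    prefixSum S m                                  ≡⟨ prefixSum≡sum S ⟩
    sum (lookup S)                                 ≡⟨ sum-cong-≗ old-signature ⟩
    sum (λ j → ∑V (bit ∘ downEdge T (inject₁ j)))  ≡⟨ ∑V-sum-comm (λ j → bit ∘ downEdge T (inject₁ j)) ⟨
    ∑V (oldDegree T)                               ≡⟨ ∑V-∷ʳ (oldDegree T) ⟩
    ∑V (λ Y → oldDegree T (Y ∷ʳ false)) + topDegrees ≡⟨ cong (_+ topDegrees) (∑V-cong oldDegree-bottom) ⟩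
    nonempties + topDegrees                        ∎

  topDegrees≡0 : topDegrees ≡ 0
  topDegrees≡0 = +-cancelˡ-≡ nonempties topDegrees 0 (+-cancelʳ-≡ 1 (nonempties + topDegrees) (nonempties + 0) (begin
    nonempties + topDegrees + 1  ≡⟨ cong (_+ 1) prefixSum≡degrees ⟨
    prefixSum S m + 1            ≡⟨ saturated ⟩
    2 ^ m                        ≡⟨ ∑V-nonempty m ⟨
    nonempties + 1               ≡⟨ cong (_+ 1) (+-identityʳ _) ⟨
    nonempties + 0 + 1           ∎))

  oldDegree-top : (Y : V m) → oldDegree T (Y ∷ʳ true) ≡ 0
  oldDegree-top = ∑V≡0⇒≡0 _ topDegrees≡0

  new-direction-full : (Y : V m) → lookupTab (lookup T (fromℕ m)) (Y ∷ʳ false) ≡ true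
  new-direction-full Y = bit≡1⇒true (begin
    bit (lookupTab (lookup T (fromℕ m)) (Y ∷ʳ false))
      ≡⟨ cong (_+ bit (lookupTab (lookup T (fromℕ m)) (Y ∷ʳ false))) (oldDegree-top Y) ⟨
    oldDegree T (Y ∷ʳ true) + bit (lookupTab (lookup T (fromℕ m)) (Y ∷ʳ false))
      ≡⟨ downDegree-top T Y ⟨
    downDegree T (Y ∷ʳ true)    ≡⟨ proj₂ descent (Y ∷ʳ true) ⟩
    bit (nonempty (Y ∷ʳ true))  ≡⟨ cong bit (nonempty-∷ʳ-true Y) ⟩
    1                           ∎)

  -- An old edge at Y ∪ {new} in direction j ∉ Y would be a down edge of Y ∪ {j, new}.
  old-directions-top : (j : Fin m) (Y : V m) → lookupTab (lookup T (inject₁ j)) (Y ∷ʳ true) ≡ false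
  old-directions-top j Y with lookup Y j in Yⱼ
  ... | true  = proj₁ descent (inject₁ j) (Y ∷ʳ true) (trans (lookup-∷ʳ-inject₁ Y true j) Yⱼ)
  ... | false = begin
    lookupTab (lookup T (inject₁ j)) (Y ∷ʳ true)
      ≡⟨ Edges.downEdge-upper T (inject₁ j) (Y ∷ʳ true) (trans (lookup-∷ʳ-inject₁ Y true j) Yⱼ) ⟨
    downEdge T (inject₁ j) ((Y ∷ʳ true) [ inject₁ j ]≔ true)  ≡⟨ cong (downEdge T (inject₁ j)) ([]≔-∷ʳ-inject₁ Y true j true) ⟩
    downEdge T (inject₁ j) ((Y [ j ]≔ true) ∷ʳ true)          ≡⟨ sum-bit≡0⇒false _ (oldDegree-top (Y [ j ]≔ true)) j ⟩
    false                                                      ∎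

  lift-restrict : lift (restrict T) ≡ T
  lift-restrict = ≗-lookup⇒≡ λ i → same-table (direction i)
    where
    same-table : {i : Fin (suc m)} → Direction m i → lookup (lift (restrict T)) i ≡ lookup T i
    same-table (old j) = begin
      lookup (lift (restrict T)) (inject₁ j)      ≡⟨ lookup-lift-old (restrict T) j ⟩
      liftTab (lookup (restrict T) j)             ≡⟨ cong liftTab (lookup∘tabulate (bottomTab ∘ lookup T ∘ inject₁) j) ⟩
      liftTab (bottomTab (lookup T (inject₁ j)))  ≡⟨ liftTab-bottomTab (lookup T (inject₁ j)) (old-directions-top j) ⟩
      lookup T (inject₁ j)                        ∎
    same-table new = trans (lookup-lift-new (restrict T)) (fullTab-unique _ λ where
      Y false → new-direction-full Y
      Y true  → proj₁ descent (fromℕ m) (Y ∷ʳ true) (lookup-∷ʳ-fromℕ Y true))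

Descent : (n : ℕ) → Vec ℕ n → EdgeSet n → Set
Descent n S T = IsDescentTree T × signature T ≡ S

UST⇔Descent : {n : ℕ} {S : Vec ℕ n} (T : EdgeSet n) → UST n S T ⇔ Descent n S T
UST⇔Descent T = mk⇔
  (λ (wf , spanning , upright , sig) → upright-spanning-tree⇒IsDescentTree T wf spanning upright , sig)
  (λ (descent , sig) → let spanning , upright = IsDescentTree⇒upright-spanning-tree T descent
                        in proj₁ descent , spanning , upright , sig)

restrict-Descent : {m : ℕ} {S : Vec ℕ m} {a : ℕ} (T : EdgeSet (suc m)) → prefixSum S m + 1 ≡ 2 ^ m →
                   Descent (suc m) (S ∷ʳ a) T → Descent m S (restrict T)
restrict-Descent {m} {S} {a} T saturated (descent , sig) =
  IsDescentTree-of-lift (restrict T) (subst IsDescentTree (sym lift-restrict) descent) ,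
  ∷ʳ-injectiveˡ _ _ (trans (sym (signature-lift (restrict T))) (trans (cong signature lift-restrict) sig))
  where
  lift-restrict : lift (restrict T) ≡ T
  lift-restrict = Saturated.lift-restrict descent sig saturated

lift-Descent : {m : ℕ} {S : Vec ℕ m} (T : EdgeSet m) → Descent m S T → Descent (suc m) (S ∷ʳ 2 ^ m) (lift T)
lift-Descent {m} T (descent , sig) = lift-IsDescentTree T descent , trans (signature-lift T) (cong (_∷ʳ 2 ^ m) sig)

collapse-new-direction : {m k : ℕ} (S : Vec ℕ m) → prefixSum S m + 1 ≡ 2 ^ m →
  NumberOf (Descent (suc m) (S ∷ʳ 2 ^ m)) k ⇔ NumberOf (Descent m S) k
collapse-new-direction S saturated = NumberOf-correspondence record
  { to        = restrict
  ; from      = lift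
  ; to-resp   = λ T → restrict-Descent T saturated
  ; from-resp = lift-Descent
  ; from∘to   = λ T (descent , sig) → Saturated.lift-restrict descent sig saturated
  ; to∘from   = λ T _ → restrict-lift T
  }

ZeroExcessFrom-init : {m r : ℕ} (S : Vec ℕ m) (a : ℕ) → ZeroExcessFrom (S ∷ʳ a) r → ZeroExcessFrom S r
ZeroExcessFrom-init S a zero-excess k r≤k k≤m =
  trans (cong (_+ 1) (sym (prefixSum-∷ʳ-≤ S a k k≤m))) (zero-excess k r≤k (m≤n⇒m≤1+n k≤m))

saturated-last : {m : ℕ} (S : Vec ℕ m) (a : ℕ) →
  prefixSum S m + 1 ≡ 2 ^ m → prefixSum (S ∷ʳ a) (suc m) + 1 ≡ 2 ^ suc m → a ≡ 2 ^ m
saturated-last {m} S a saturated saturated′ = +-cancelˡ-≡ (2 ^ m) a (2 ^ m) (begin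
  2 ^ m + a                    ≡⟨ cong (_+ a) saturated ⟨
  prefixSum S m + 1 + a        ≡⟨ +-assoc (prefixSum S m) 1 a ⟩
  prefixSum S m + (1 + a)      ≡⟨ cong (prefixSum S m +_) (+-comm 1 a) ⟩
  prefixSum S m + (a + 1)      ≡⟨ +-assoc (prefixSum S m) a 1 ⟨
  prefixSum S m + a + 1        ≡⟨ cong (_+ 1) (prefixSum-∷ʳ S a) ⟨
  prefixSum (S ∷ʳ a) (suc m) + 1 ≡⟨ saturated′ ⟩
  2 ^ m + (2 ^ m + 0)          ≡⟨ cong (2 ^ m +_) (+-identityʳ _) ⟩
  2 ^ m + 2 ^ m                ∎)
  where open ≡-Reasoning

truncate-all : {n : ℕ} (S : Vec ℕ n) (n≤n : n ≤ n) → truncate S n n≤n ≡ S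
truncate-all S n≤n = ≗-lookup⇒≡ λ i → trans (lookup∘tabulate _ i) (cong (lookup S) (Finₚ.inject≤-refl i n≤n))

truncate-∷ʳ : {m r : ℕ} (S : Vec ℕ m) (a : ℕ) (r≤1+m : r ≤ suc m) (r≤m : r ≤ m) →
              truncate (S ∷ʳ a) r r≤1+m ≡ truncate S r r≤m
truncate-∷ʳ S a r≤1+m r≤m = tabulate-cong λ i → trans (cong (lookup (S ∷ʳ a)) (inject≤≡inject₁ i))
                                                      (lookup-∷ʳ-inject₁ S a (inject≤ i r≤m))
  where
  inject≤≡inject₁ : ∀ i → inject≤ i r≤1+m ≡ inject₁ (inject≤ i r≤m)
  inject≤≡inject₁ i = Finₚ.toℕ-injective
    (trans (Finₚ.toℕ-inject≤ i r≤1+m) (sym (trans (Finₚ.toℕ-inject₁ _) (Finₚ.toℕ-inject≤ i r≤m))))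

saturated-reduction : (n : ℕ) (S : Vec ℕ n) (r : ℕ) (r≤n : r ≤ n) → ZeroExcessFrom S r → (k : ℕ) →
  NumberOf (Descent n S) k ⇔ NumberOf (Descent r (truncate S r r≤n)) k
saturated-reduction n S r r≤n zero-excess k with m≤n⇒m<n∨m≡n r≤n
... | inj₂ refl = begin
  NumberOf (Descent n S) k                     ≡⟨ cong (λ v → NumberOf (Descent n v) k) (truncate-all S r≤n) ⟨
  NumberOf (Descent n (truncate S n r≤n)) k    ∎
  where open SetoidReasoning (⇔-setoid 0ℓ)
saturated-reduction (suc m) S r r≤n zero-excess k | inj₁ (s≤s r≤m) with S′ , a , refl ← initLast S = begin
  NumberOf (Descent (suc m) (S′ ∷ʳ a)) k          ≡⟨ cong (λ b → NumberOf (Descent (suc m) (S′ ∷ʳ b)) k) a≡2^m ⟩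
  NumberOf (Descent (suc m) (S′ ∷ʳ 2 ^ m)) k      ≈⟨ collapse-new-direction S′ saturated ⟩
  NumberOf (Descent m S′) k                       ≈⟨ saturated-reduction m S′ r r≤m zero-excess′ k ⟩
  NumberOf (Descent r (truncate S′ r r≤m)) k      ≡⟨ cong (λ v → NumberOf (Descent r v) k) (truncate-∷ʳ S′ a r≤n r≤m) ⟨
  NumberOf (Descent r (truncate (S′ ∷ʳ a) r r≤n)) k ∎
  where
  open SetoidReasoning (⇔-setoid 0ℓ)
  zero-excess′ : ZeroExcessFrom S′ r
  zero-excess′ = ZeroExcessFrom-init S′ a zero-excess
  saturated : prefixSum S′ m + 1 ≡ 2 ^ m
  saturated = zero-excess′ m r≤m ≤-refl
  a≡2^m : a ≡ 2 ^ m
  a≡2^m = saturated-last S′ a saturated (zero-excess (suc m) (m≤n⇒m≤1+n r≤m) ≤-refl)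

corollary5p4 : (n : ℕ) (S : Vec ℕ n) → Ordered S → IsSignature n S →
    ((r : ℕ) (sat : SaturatedAbove S r) → (k : ℕ) →
      NumberOf (UST n S) k ⇔ NumberOf (UST r (truncate S r (<⇒≤ (proj₁ sat)))) k)
    ×
    ((s : ℕ) (s≤n : s ≤ n) → IsUnsatIndex S s → (k : ℕ) →
      NumberOf (UST n S) k ⇔ NumberOf (UST s (truncate S s s≤n)) k)
corollary5p4 n S _ _ =
  (λ r (r<n , zero-excess) k → reduce r (<⇒≤ r<n) zero-excess k) ,
  (λ s s≤n (zero-excess , _) k → reduce s s≤n zero-excess k)
  where
  reduce : (r : ℕ) (r≤n : r ≤ n) → ZeroExcessFrom S r → (k : ℕ) →
           NumberOf (UST n S) k ⇔ NumberOf (UST r (truncate S r r≤n)) k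
  reduce r r≤n zero-excess k = begin
    NumberOf (UST n S) k                             ≈⟨ NumberOf-cong UST⇔Descent ⟩
    NumberOf (Descent n S) k                         ≈⟨ saturated-reduction n S r r≤n zero-excess k ⟩
    NumberOf (Descent r (truncate S r r≤n)) k        ≈⟨ NumberOf-cong UST⇔Descent ⟨
    NumberOf (UST r (truncate S r r≤n)) k            ∎
    where open SetoidReasoning (⇔-setoid 0ℓ)
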